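{- For any graph $G$ on $K$ vertices and any integer $m$ with $3\le m\le K$, if the average degree of $G$ is at least $m$, then $G$ contains a connected-matching on at least $m$ vertices.
   Context: A matching is a set of pairwise vertex-disjoint edges; a connected-matching is a matching all of whose edges lie in the same connected component of $G$; a matching is on at least $m$ vertices if it covers at least $m$ vertices. -}

module Defs where

open import Data.Bool using (Bool; true; false; if_then_else_)
open import Data.Nat using (ℕ; _+_; _*_)
open import Data.Fin using (Fin)
open import Data.List using (List; []; _∷_; map; allFin; length; concatMap)
open import Data.Nat.ListAction using (sum)
open import Data.List.Relation.Unary.All using (All)
open import Data.List.Relation.Unary.Unique.Propositional using (Unique)
open import Data.Product using (Σ; _×_; _,_; proj₁; proj₂; ∃)
open import Relation.Binary.PropositionalEquality using (_≡_)
open import Relation.Binary.Construct.Closure.ReflexiveTransitive using (Star)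

record Graph (K : ℕ) : Set where
  field
    adj   : Fin K → Fin K → Bool
    sym   : ∀ u v → adj u v ≡ adj v u
    irrfl : ∀ v → adj v v ≡ false

open Graph public

Adjacent : ∀ {K} → Graph K → Fin K → Fin K → Set
Adjacent G u v = adj G u v ≡ true

degree : ∀ {K} → Graph K → Fin K → ℕ
degree {K} G v = sum (map (λ u → if adj G v u then 1 else 0) (allFin K))

-- sum of all degrees; average degree ≥ m  ⇔  degreeSum ≥ m * K
degreeSum : ∀ {K} → Graph K → ℕ
degreeSum {K} G = sum (map (degree G) (allFin K))

Reachable : ∀ {K} → Graph K → Fin K → Fin K → Set
Reachable G = Star (Adjacent G)

Edge : ∀ {K} → Graph K → Set
Edge {K} G = Σ (Fin K × Fin K) λ p → Adjacent G (proj₁ p) (proj₂ p)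

endpoints : ∀ {K} {G : Graph K} → List (Edge G) → List (Fin K)
endpoints = concatMap (λ e → proj₁ (proj₁ e) ∷ proj₂ (proj₁ e) ∷ [])

-- a matching: pairwise vertex-disjoint edges (all endpoints distinct)
IsMatching : ∀ {K} (G : Graph K) → List (Edge G) → Set
IsMatching G M = Unique (endpoints {G = G} M)

IsConnectedMatching : ∀ {K} (G : Graph K) → List (Edge G) → Set
IsConnectedMatching {K} G M =
  IsMatching G M × ∃ λ (c : Fin K) → All (Reachable G c) (endpoints {G = G} M)

covered : ∀ {K} {G : Graph K} → List (Edge G) → ℕ
covered {G = G} M = length (endpoints {G = G} M)

module Submission where

-- Call a nonempty vertex set S dense if the induced subgraph G[S] has average degree at
-- least m, i.e. degree sum at least m |S|; by hypothesis the whole vertex set is dense.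
-- (1) Every dense set contains a core: a set whose vertices are all reachable from one
--     root, of minimum degree above m/2 and with more than m vertices.  By induction on
--     |S|: delete a vertex of degree at most m/2 (density survives); otherwise, if G[S]
--     is disconnected, a component or its complement is again dense; otherwise S itself
--     is a core, as its degree sum is at most |S| (|S| - 1).
-- (2) In a core, a matching covering fewer than m vertices can be enlarged: add an edge
--     between two uncovered vertices, or exchange a matching edge ab for xa and yb with
--     x ≠ y uncovered.  If neither is possible, two uncovered vertices u ≠ v exist, all
--     their neighbours are covered and each matching edge meets at most two edges at u or
--     v, so m < deg u + deg v ≤ (number of covered vertices), a contradiction.

open import Data.Bool using (Bool; true; false; if_then_else_; _∧_; _∨_)
open import Data.Bool.Properties using (∧-zeroʳ; ∨-zeroʳ) renaming (_≟_ to _≟ᴮ_)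
open import Data.Empty using (⊥)
open import Data.Fin using (Fin; zero; suc)
open import Data.Fin.Properties using (_≟_; any?)
open import Data.List using (List; []; _∷_; _++_; map; tabulate; length)
open import Data.List.Properties using (concatMap-++)
open import Data.List.Membership.Propositional using (_∈_; _∉_; find)
open import Data.List.Membership.Propositional.Properties using (∈-∃++)
import Data.List.Membership.DecPropositional as DecMembership
open import Data.List.Relation.Unary.All as All using (All; []; _∷_)
open import Data.List.Relation.Unary.All.Properties using (¬Any⇒All¬)
open import Data.List.Relation.Unary.AllPairs using ([]; _∷_)
open import Data.List.Relation.Unary.Any as Any using (Any)
open import Data.List.Relation.Unary.Unique.Propositional using (Unique)
open import Data.List.Relation.Unary.Unique.Propositional.Properties using (Unique[x∷xs]⇒x∉xs)
open import Data.List.Relation.Binary.Permutation.Propositional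
  using (_↭_; ↭-refl; ↭-prep; ↭-swap; ↭-sym; ↭⇒↭ₛ; module PermutationReasoning)
open import Data.List.Relation.Binary.Permutation.Propositional.Properties
  using (shift; All-resp-↭; ↭-length)
import Data.List.Relation.Binary.Permutation.Setoid.Properties as SetoidPermutation
open import Data.Nat using (ℕ; zero; suc; pred; _+_; _*_; _≤_; _<_; z≤n; s≤s)
open import Data.Nat.ListAction using () renaming (sum to listSum)
open import Data.Nat.Properties
  using (≤-refl; ≤-trans; ≤-reflexive; ≤-pred; <⇒≱; ≰⇒>; <-irrefl; <-asym; ≮⇒≥; <-≤-trans; _≤?_;
         n<1+n; n≤1+n; m≤m+n; m≤n+m; m<m+n; m<n+m; suc[m]≤n⇒m≤pred[n];
         +-comm; +-assoc; +-suc; +-identityʳ; *-comm; *-suc; *-identityʳ; *-distribˡ-+;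
         +-mono-≤; +-monoˡ-≤; +-mono-<; +-mono-<-≤; +-mono-≤-<; +-cancelˡ-≤; *-cancelʳ-≤;
         +-*-semiring; module ≤-Reasoning)
open import Data.Nat.Tactic.RingSolver using (solve-∀)
open import Data.Product using (Σ; _×_; _,_; proj₁; proj₂; ∃; ∃₂)
open import Data.Sum using (_⊎_; inj₁; inj₂; [_,_])
open import Function using (_∘_; id)
open import Relation.Binary.Construct.Closure.ReflexiveTransitive using (ε; _◅_; _◅◅_)
open import Relation.Binary.PropositionalEquality hiding ([_])
open import Relation.Nullary using (¬_; Dec; does; yes; no; contradiction; ¬?)
open import Relation.Nullary.Decidable using (dec-true; dec-false; _×-dec_)
open import Relation.Unary using (Decidable)
open import Algebra.Properties.Semiring.Sum +-*-semiring
  using (sum; sum-syntax; sum-cong-≗; ∑-distrib-+; *-distribʳ-sum)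

open import Defs hiding (sym)

⟦_⟧ : Bool → ℕ
⟦ b ⟧ = if b then 1 else 0

⟦⟧-pos : ∀ b → 0 < ⟦ b ⟧ → b ≡ true
⟦⟧-pos true _ = refl

⟦⟧≤1 : ∀ b → ⟦ b ⟧ ≤ 1
⟦⟧≤1 true  = ≤-refl
⟦⟧≤1 false = z≤n

⟦∧⟧≤ : ∀ a b → ⟦ a ∧ b ⟧ ≤ ⟦ b ⟧
⟦∧⟧≤ true  b = ≤-refl
⟦∧⟧≤ false b = z≤n

holds : ∀ {A : Set} (a? : Dec A) → 0 < ⟦ does a? ⟧ → A
holds (yes a) _ = a

at-most-one : ∀ p s → (p ≡ true → s ≡ true → ⊥) → ⟦ p ⟧ + ⟦ s ⟧ ≤ 1
at-most-one true  true  excl = contradiction refl (excl refl)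
at-most-one true  false _    = ≤-refl
at-most-one false s     _    = ⟦⟧≤1 s

at-most-two : ∀ p q r s → (p ≡ true → s ≡ true → ⊥) → (q ≡ true → r ≡ true → ⊥) →
  ⟦ p ⟧ + ⟦ q ⟧ + (⟦ r ⟧ + ⟦ s ⟧) ≤ 2
at-most-two p q r s ps qr = begin
  ⟦ p ⟧ + ⟦ q ⟧ + (⟦ r ⟧ + ⟦ s ⟧)    ≡⟨ regroup ⟦ p ⟧ ⟦ q ⟧ ⟦ r ⟧ ⟦ s ⟧ ⟩
  (⟦ p ⟧ + ⟦ s ⟧) + (⟦ q ⟧ + ⟦ r ⟧)  ≤⟨ +-mono-≤ (at-most-one p s ps) (at-most-one q r qr) ⟩
  2                                  ∎
  where
  open ≤-Reasoning
  regroup : ∀ a b c d → a + b + (c + d) ≡ (a + d) + (b + c)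
  regroup = solve-∀

mean-bound : ∀ {m a b} → m < a + a → m < b + b → m < a + b
mean-bound {m} {a} {b} m<2a m<2b with a + b ≤? m
... | no  a+b≰m = ≰⇒> a+b≰m
... | yes a+b≤m = contradiction (+-mono-≤ a+b≤m a+b≤m)
  (<⇒≱ (subst (m + m <_) (regroup a b) (+-mono-< m<2a m<2b)))
  where
  regroup : ∀ a b → a + a + (b + b) ≡ (a + b) + (a + b)
  regroup = solve-∀

VertexSet : ℕ → Set
VertexSet K = Fin K → Bool

⁅_⁆ : ∀ {K} → Fin K → VertexSet K
⁅ w ⁆ u = does (u ≟ w)

_∪_ : ∀ {K} → VertexSet K → VertexSet K → VertexSet K
(C ∪ D) u = C u ∨ D u

_∖_ : ∀ {K} → VertexSet K → VertexSet K → VertexSet K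
(S ∖ C) u = if C u then false else S u

⁅⁆-eq : ∀ {K} {u w : Fin K} → ⁅ w ⁆ u ≡ true → u ≡ w
⁅⁆-eq {u = u} {w} u∈ with u ≟ w
... | yes u≡w = u≡w

∪⁅⁆-cases : ∀ {K} (C : VertexSet K) {w u} → (C ∪ ⁅ w ⁆) u ≡ true → C u ≡ true ⊎ u ≡ w
∪⁅⁆-cases C {w} {u} u∈ with C u
... | true  = inj₁ refl
... | false = inj₂ (⁅⁆-eq u∈)

∖-⊆ : ∀ {K} (S C : VertexSet K) {u} → (S ∖ C) u ≡ true → S u ≡ true
∖-⊆ S C {u} u∈ with C u
... | false = u∈

∈-∖ : ∀ {K} (S C : VertexSet K) {u} → S u ≡ true → C u ≡ false → (S ∖ C) u ≡ true
∈-∖ S C Su Cu rewrite Cu = Su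

infix 4 _∈?_
_∈?_ : ∀ {K} (x : Fin K) (xs : List (Fin K)) → Dec (x ∈ xs)
_∈?_ {K} = DecMembership._∈?_ (_≟_ {K})

∑-mono : ∀ {K} {f g : Fin K → ℕ} → (∀ i → f i ≤ g i) → sum f ≤ sum g
∑-mono {zero}  f≤g = z≤n
∑-mono {suc K} f≤g = +-mono-≤ (f≤g zero) (∑-mono (f≤g ∘ suc))

∑-mono-< : ∀ {K} {f g : Fin K → ℕ} → (∀ i → f i ≤ g i) → ∀ j → f j < g j → sum f < sum g
∑-mono-< {suc K} f≤g zero    fj<gj = +-mono-<-≤ fj<gj (∑-mono (f≤g ∘ suc))
∑-mono-< {suc K} f≤g (suc j) fj<gj = +-mono-≤-< (f≤g zero) (∑-mono-< (f≤g ∘ suc) j fj<gj)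

summand≤∑ : ∀ {K} (f : Fin K → ℕ) i → f i ≤ sum f
summand≤∑ {suc K} f zero    = m≤m+n _ _
summand≤∑ {suc K} f (suc i) = ≤-trans (summand≤∑ (f ∘ suc) i) (m≤n+m _ _)

∑-pos : ∀ {K} (f : Fin K → ℕ) → 0 < sum f → ∃ λ i → 0 < f i
∑-pos {suc K} f pos with f zero in eq
... | suc _ = zero , subst (0 <_) (sym eq) (s≤s z≤n)
... | zero with ∑-pos (f ∘ suc) pos
...   | i , fi>0 = suc i , fi>0

∑-zero : ∀ {K} (f : Fin K → ℕ) → (∀ i → f i ≡ 0) → sum f ≡ 0
∑-zero {zero}  f f≡0 = refl
∑-zero {suc K} f f≡0 = cong₂ _+_ (f≡0 zero) (∑-zero (f ∘ suc) (f≡0 ∘ suc))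

∑-point : ∀ {K} (w : Fin K) (f : Fin K → ℕ) → ∑[ u < K ] (⟦ ⁅ w ⁆ u ⟧ * f u) ≡ f w
∑-point {suc K} zero f =
  trans (cong₂ _+_ (+-identityʳ (f zero)) (∑-zero {K} _ (λ _ → refl))) (+-identityʳ (f zero))
∑-point {suc K} (suc w) f = ∑-point w (f ∘ suc)

∑-one : ∀ K → ∑[ i < K ] 1 ≡ K
∑-one zero    = refl
∑-one (suc K) = cong suc (∑-one K)

listSum-tabulate : ∀ {A : Set} {K} (f : A → ℕ) (g : Fin K → A) →
  listSum (map f (tabulate g)) ≡ ∑[ i < K ] f (g i)
listSum-tabulate {K = zero}  f g = refl
listSum-tabulate {K = suc K} f g = cong (f (g zero) +_) (listSum-tabulate f (g ∘ suc))

listSum-ones : ∀ {A : Set} (xs : List A) → listSum (map (λ _ → 1) xs) ≡ length xs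
listSum-ones []       = refl
listSum-ones (_ ∷ xs) = cong suc (listSum-ones xs)

∑-members : ∀ {K} (W : List (Fin K)) → Unique W → (g : Fin K → ℕ) →
  ∑[ w < K ] (⟦ does (w ∈? W) ⟧ * g w) ≡ listSum (map g W)
∑-members {K} [] [] g = ∑-zero {K} _ (λ _ → refl)
∑-members {K} (x ∷ W) unique@(_ ∷ uniqueW) g = begin
  ∑[ w < K ] (⟦ does (w ∈? x ∷ W) ⟧ * g w)                  ≡⟨ sum-cong-≗ split ⟩
  ∑[ w < K ] (⟦ ⁅ x ⁆ w ⟧ * g w + ⟦ does (w ∈? W) ⟧ * g w)  ≡⟨ ∑-distrib-+ {K} _ _ ⟩
  ∑[ w < K ] (⟦ ⁅ x ⁆ w ⟧ * g w) + ∑[ w < K ] (⟦ does (w ∈? W) ⟧ * g w)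
                                                            ≡⟨ cong₂ _+_ (∑-point x g) (∑-members W uniqueW g) ⟩
  g x + listSum (map g W)                                   ∎
  where
  open ≡-Reasoning
  split : ∀ (w : Fin K) → ⟦ does (w ∈? x ∷ W) ⟧ * g w ≡ ⟦ ⁅ x ⁆ w ⟧ * g w + ⟦ does (w ∈? W) ⟧ * g w
  split w with w ≟ x
  ... | yes refl rewrite dec-false (w ∈? W) (Unique[x∷xs]⇒x∉xs unique) = sym (+-identityʳ _)
  ... | no _ = refl

count-without : ∀ {K} {P : Fin K → Set} (P? : Decidable P) i →
  ∑[ j < K ] ⟦ does (P? j) ⟧ ≤ 1 + ∑[ j < K ] ⟦ does (P? j ×-dec ¬? (j ≟ i)) ⟧
count-without {K} {P} P? i = begin
  ∑[ j < K ] ⟦ does (P? j) ⟧                              ≤⟨ ∑-mono split ⟩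
  ∑[ j < K ] (⟦ ⁅ i ⁆ j ⟧ * 1 + ⟦ does (others? j) ⟧)     ≡⟨ ∑-distrib-+ {K} _ _ ⟩
  ∑[ j < K ] (⟦ ⁅ i ⁆ j ⟧ * 1) + #others                  ≡⟨ cong (_+ #others) (∑-point i (λ _ → 1)) ⟩
  1 + #others                                             ∎
  where
  open ≤-Reasoning
  others? : ∀ j → Dec (P j × j ≢ i)
  others? j = P? j ×-dec ¬? (j ≟ i)
  #others : ℕ
  #others = ∑[ j < K ] ⟦ does (others? j) ⟧
  split : ∀ j → ⟦ does (P? j) ⟧ ≤ ⟦ ⁅ i ⁆ j ⟧ * 1 + ⟦ does (others? j) ⟧
  split j with P? j | j ≟ i
  ... | yes _ | yes _ = ≤-refl
  ... | yes _ | no _  = ≤-refl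
  ... | no _  | _     = z≤n

two-witnesses : ∀ {K} {P : Fin K → Set} (P? : Decidable P) → 2 ≤ ∑[ i < K ] ⟦ does (P? i) ⟧ →
  ∃₂ λ i j → i ≢ j × P i × P j
two-witnesses {K} {P} P? two
  with i , i-counted ← ∑-pos (λ i → ⟦ does (P? i) ⟧) (≤-trans (s≤s z≤n) two)
  with j , j-counted ← ∑-pos (λ j → ⟦ does (P? j ×-dec ¬? (j ≟ i)) ⟧)
                             (+-cancelˡ-≤ 1 1 _ (≤-trans two (count-without P? i)))
  with Pj , j≢i ← holds (P? j ×-dec ¬? (j ≟ i)) j-counted
  = i , j , (λ i≡j → j≢i (sym i≡j)) , holds (P? i) i-counted , Pj

size : ∀ {K} → VertexSet K → ℕ
size {K} S = ∑[ u < K ] ⟦ S u ⟧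

size-pos : ∀ {K} (S : VertexSet K) {w} → S w ≡ true → 0 < size S
size-pos S {w} Sw = subst (λ b → ⟦ b ⟧ ≤ size S) Sw (summand≤∑ (λ u → ⟦ S u ⟧) w)

size-∖-∪⁅⁆ : ∀ {K} (S C : VertexSet K) {w} → (S ∖ C) w ≡ true → size (S ∖ (C ∪ ⁅ w ⁆)) < size (S ∖ C)
size-∖-∪⁅⁆ S C {w} w∉C = ∑-mono-< pointwise w strict
  where
  pointwise : ∀ u → ⟦ (S ∖ (C ∪ ⁅ w ⁆)) u ⟧ ≤ ⟦ (S ∖ C) u ⟧
  pointwise u with C u | u ≟ w
  ... | true  | _     = ≤-refl
  ... | false | yes _ = z≤n
  ... | false | no _  = ≤-refl
  strict : ⟦ (S ∖ (C ∪ ⁅ w ⁆)) w ⟧ < ⟦ (S ∖ C) w ⟧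
  strict rewrite w∉C | dec-true (w ≟ w) refl | ∨-zeroʳ (C w) = s≤s z≤n

size-remove : ∀ {K} (S : VertexSet K) {w} → S w ≡ true → size S ≡ suc (size (S ∖ ⁅ w ⁆))
size-remove {K} S {w} Sw = begin
  size S                                            ≡⟨ sum-cong-≗ split ⟩
  ∑[ u < K ] (⟦ ⁅ w ⁆ u ⟧ * 1 + ⟦ (S ∖ ⁅ w ⁆) u ⟧)  ≡⟨ ∑-distrib-+ {K} _ _ ⟩
  ∑[ u < K ] (⟦ ⁅ w ⁆ u ⟧ * 1) + size (S ∖ ⁅ w ⁆)   ≡⟨ cong (_+ size (S ∖ ⁅ w ⁆)) (∑-point w _) ⟩
  suc (size (S ∖ ⁅ w ⁆))                            ∎
  where
  open ≡-Reasoning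
  split : ∀ u → ⟦ S u ⟧ ≡ ⟦ ⁅ w ⁆ u ⟧ * 1 + ⟦ (S ∖ ⁅ w ⁆) u ⟧
  split u with u ≟ w
  ... | yes refl rewrite Sw = refl
  ... | no _ = refl

module _ {K : ℕ} (G : Graph K) where

  deg : VertexSet K → Fin K → ℕ
  deg S v = ∑[ u < K ] ⟦ S u ∧ adj G v u ⟧

  degTotal : VertexSet K → ℕ
  degTotal S = ∑[ v < K ] (if S v then deg S v else 0)

  Dense : ℕ → VertexSet K → Set
  Dense m S = 0 < size S × m * size S ≤ degTotal S

  -- A vertex of S has fewer neighbours in S than S has elements (no loops).
  deg<size : ∀ S {v} → S v ≡ true → deg S v < size S
  deg<size S {v} Sv = begin-strict
    deg S v                                             <⟨ n<1+n _ ⟩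
    1 + deg S v                                         ≡⟨ cong (_+ deg S v) (sym (∑-point v (λ _ → 1))) ⟩
    ∑[ u < K ] (⟦ ⁅ v ⁆ u ⟧ * 1) + deg S v              ≡⟨ sym (∑-distrib-+ {K} _ _) ⟩
    ∑[ u < K ] (⟦ ⁅ v ⁆ u ⟧ * 1 + ⟦ S u ∧ adj G v u ⟧)  ≤⟨ ∑-mono bound ⟩
    size S                                              ∎
    where
    open ≤-Reasoning
    bound : ∀ u → ⟦ ⁅ v ⁆ u ⟧ * 1 + ⟦ S u ∧ adj G v u ⟧ ≤ ⟦ S u ⟧
    bound u with u ≟ v
    ... | yes refl rewrite Sv | irrfl G u = ≤-refl
    ... | no _ with S u
    ...   | true  = ⟦⟧≤1 (adj G v u)
    ...   | false = z≤n

  degTotal≤ : ∀ S → degTotal S ≤ size S * pred (size S)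
  degTotal≤ S = begin
    degTotal S                            ≤⟨ ∑-mono bound ⟩
    ∑[ v < K ] (⟦ S v ⟧ * pred (size S))  ≡⟨ sym (*-distribʳ-sum {K} (pred (size S)) _) ⟩
    size S * pred (size S)                ∎
    where
    open ≤-Reasoning
    bound : ∀ v → (if S v then deg S v else 0) ≤ ⟦ S v ⟧ * pred (size S)
    bound v with S v in Sv
    ... | true  = ≤-trans (suc[m]≤n⇒m≤pred[n] (deg<size S Sv)) (≤-reflexive (sym (+-identityʳ _)))
    ... | false = z≤n

  -- A dense set has more than m elements: m |S| ≤ degTotal S ≤ |S| (|S| - 1).
  dense⇒large : ∀ {m} S → Dense m S → m < size S
  dense⇒large {m} S (nonempty , dense) with size S | degTotal≤ S
  ... | suc s | total≤ = s≤s (*-cancelʳ-≤ m s (suc s) (begin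
    m * suc s   ≤⟨ dense ⟩
    degTotal S  ≤⟨ total≤ ⟩
    suc s * s   ≡⟨ *-comm (suc s) s ⟩
    s * suc s   ∎))
    where open ≤-Reasoning

  deg-remove : ∀ S w v → deg S v ≤ ⟦ adj G v w ⟧ + deg (S ∖ ⁅ w ⁆) v
  deg-remove S w v = begin
    deg S v                            ≤⟨ ∑-mono bound ⟩
    ∑[ u < K ] (⟦ ⁅ w ⁆ u ⟧ * ⟦ adj G v u ⟧ + ⟦ (S ∖ ⁅ w ⁆) u ∧ adj G v u ⟧)
                                       ≡⟨ ∑-distrib-+ {K} _ _ ⟩
    ∑[ u < K ] (⟦ ⁅ w ⁆ u ⟧ * ⟦ adj G v u ⟧) + deg (S ∖ ⁅ w ⁆) v
                                       ≡⟨ cong (_+ deg (S ∖ ⁅ w ⁆) v) (∑-point w _) ⟩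
    ⟦ adj G v w ⟧ + deg (S ∖ ⁅ w ⁆) v  ∎
    where
    open ≤-Reasoning
    bound : ∀ u → ⟦ S u ∧ adj G v u ⟧ ≤ ⟦ ⁅ w ⁆ u ⟧ * ⟦ adj G v u ⟧ + ⟦ (S ∖ ⁅ w ⁆) u ∧ adj G v u ⟧
    bound u with u ≟ w | S u
    ... | yes refl | true  = ≤-trans (m≤m+n _ 0) (m≤m+n _ 0)
    ... | yes refl | false = z≤n
    ... | no _     | _     = ≤-refl

  degTotal-remove : ∀ S {w} → S w ≡ true → degTotal S ≤ deg S w + deg S w + degTotal (S ∖ ⁅ w ⁆)
  degTotal-remove S {w} Sw = begin
    degTotal S                                ≤⟨ ∑-mono bound ⟩
    ∑[ v < K ] (⟦ ⁅ w ⁆ v ⟧ * deg S w + ⟦ S v ∧ adj G w v ⟧ + (if (S ∖ ⁅ w ⁆) v then deg (S ∖ ⁅ w ⁆) v else 0))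
                                              ≡⟨ ∑-distrib-+ {K} _ _ ⟩
    ∑[ v < K ] (⟦ ⁅ w ⁆ v ⟧ * deg S w + ⟦ S v ∧ adj G w v ⟧) + degTotal (S ∖ ⁅ w ⁆)
                                              ≡⟨ cong (_+ degTotal (S ∖ ⁅ w ⁆)) (∑-distrib-+ {K} _ _) ⟩
    ∑[ v < K ] (⟦ ⁅ w ⁆ v ⟧ * deg S w) + deg S w + degTotal (S ∖ ⁅ w ⁆)
                                              ≡⟨ cong (λ d → d + deg S w + degTotal (S ∖ ⁅ w ⁆)) (∑-point w _) ⟩
    deg S w + deg S w + degTotal (S ∖ ⁅ w ⁆)  ∎
    where
    open ≤-Reasoning
    bound : ∀ v → (if S v then deg S v else 0) ≤
      ⟦ ⁅ w ⁆ v ⟧ * deg S w + ⟦ S v ∧ adj G w v ⟧ + (if (S ∖ ⁅ w ⁆) v then deg (S ∖ ⁅ w ⁆) v else 0)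
    bound v with v ≟ w
    ... | yes refl rewrite Sw = ≤-trans (m≤m+n _ 0) (≤-trans (m≤m+n _ _) (m≤m+n _ 0))
    ... | no _ with S v
    ...   | true  = subst (λ a → deg S v ≤ ⟦ a ⟧ + deg (S ∖ ⁅ w ⁆) v) (Graph.sym G v w) (deg-remove S w v)
    ...   | false = z≤n

  remove-sparse : ∀ m S {w} → 0 < m → S w ≡ true → deg S w + deg S w ≤ m → m * size S ≤ degTotal S →
    Dense m (S ∖ ⁅ w ⁆)
  remove-sparse m S {w} m>0 Sw sparse dense = nonempty , dense′
    where
    S′ : VertexSet K
    S′ = S ∖ ⁅ w ⁆
    dense-remove : m * size S ≤ deg S w + deg S w + degTotal S′
    dense-remove = ≤-trans dense (degTotal-remove S Sw)
    dense′ : m * size S′ ≤ degTotal S′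
    dense′ = +-cancelˡ-≤ m _ _ (begin
      m + m * size S′                  ≡⟨ sym (*-suc m (size S′)) ⟩
      m * suc (size S′)                ≡⟨ cong (m *_) (sym (size-remove S Sw)) ⟩
      m * size S                       ≤⟨ dense-remove ⟩
      deg S w + deg S w + degTotal S′  ≤⟨ +-monoˡ-≤ (degTotal S′) sparse ⟩
      m + degTotal S′                  ∎)
      where open ≤-Reasoning
    -- if S′ were empty, S = {w} would have no edges at all
    nonempty : 0 < size S′
    nonempty with size S′ in S′-size
    ... | suc _ = s≤s z≤n
    ... | zero = contradiction (begin
      m * 1                            ≡⟨ cong (m *_) (sym singleton) ⟩
      m * size S                       ≤⟨ dense-remove ⟩
      deg S w + deg S w + degTotal S′  ≤⟨ +-mono-≤ (+-mono-≤ isolated isolated) (degTotal≤ S′) ⟩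
      0 + size S′ * pred (size S′)     ≡⟨ cong (λ s → s * pred s) S′-size ⟩
      0                                ∎) (<⇒≱ (subst (0 <_) (sym (*-identityʳ m)) m>0))
      where
      open ≤-Reasoning
      singleton : size S ≡ 1
      singleton = trans (size-remove S Sw) (cong suc S′-size)
      isolated : deg S w ≤ 0
      isolated = suc[m]≤n⇒m≤pred[n] (subst (deg S w <_) singleton (deg<size S Sw))

  Closed : VertexSet K → VertexSet K → Set
  Closed S C = ∀ {v w} → C v ≡ true → S w ≡ true → Adjacent G v w → C w ≡ true

  -- For C ⊆ S closed in S, the graph G[S] is the disjoint union of G[C] and G[S ∖ C].
  module Split (S C : VertexSet K) (C⊆S : ∀ {v} → C v ≡ true → S v ≡ true) (closed : Closed S C) where

    size-split : size S ≡ size C + size (S ∖ C)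
    size-split = trans (sum-cong-≗ pointwise) (∑-distrib-+ {K} _ _)
      where
      pointwise : ∀ u → ⟦ S u ⟧ ≡ ⟦ C u ⟧ + ⟦ (S ∖ C) u ⟧
      pointwise u with C u in Cu
      ... | true  rewrite C⊆S Cu = refl
      ... | false = refl

    nbrs-in-C : ∀ {v} → C v ≡ true → ∀ u → (S u ∧ adj G v u) ≡ (C u ∧ adj G v u)
    nbrs-in-C {v} Cv u with adj G v u in vu | S u in Su | C u in Cu
    ... | false | s     | c     = trans (∧-zeroʳ s) (sym (∧-zeroʳ c))
    ... | true  | true  | true  = refl
    ... | true  | true  | false = contradiction (trans (sym (closed Cv Su vu)) Cu) λ ()
    ... | true  | false | false = refl
    ... | true  | false | true  = contradiction (trans (sym (C⊆S Cu)) Su) λ ()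

    nbrs-in-rest : ∀ {v} → (S ∖ C) v ≡ true → ∀ u → (S u ∧ adj G v u) ≡ ((S ∖ C) u ∧ adj G v u)
    nbrs-in-rest {v} v∉C u with C v in Cv | C u in Cu | adj G v u in vu
    ... | false | false | _     = refl
    ... | false | true  | false = ∧-zeroʳ (S u)
    ... | false | true  | true  =
      contradiction (trans (sym (closed Cu v∉C (trans (Graph.sym G u v) vu))) Cv) λ ()

    -- ... and no edge of G[S] joins C to S ∖ C, so the degree sums add up as well
    degTotal-split : degTotal S ≡ degTotal C + degTotal (S ∖ C)
    degTotal-split = trans (sum-cong-≗ pointwise) (∑-distrib-+ {K} _ _)
      where
      pointwise : ∀ v → (if S v then deg S v else 0) ≡
        (if C v then deg C v else 0) + (if (S ∖ C) v then deg (S ∖ C) v else 0)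
      pointwise v with C v in Cv
      ... | true rewrite C⊆S Cv = trans (sum-cong-≗ (cong ⟦_⟧ ∘ nbrs-in-C Cv)) (sym (+-identityʳ _))
      ... | false with S v in Sv
      ...   | true  = sum-cong-≗ (cong ⟦_⟧ ∘ nbrs-in-rest (∈-∖ S C Sv Cv))
      ...   | false = refl

    dense-part : ∀ m → m * size S ≤ degTotal S →
      m * size C ≤ degTotal C ⊎ m * size (S ∖ C) ≤ degTotal (S ∖ C)
    dense-part m dense with m * size C ≤? degTotal C | m * size (S ∖ C) ≤? degTotal (S ∖ C)
    ... | yes denseC | _        = inj₁ denseC
    ... | no _       | yes denseD = inj₂ denseD
    ... | no sparseC | no sparseD = contradiction (begin-strict
      degTotal C + degTotal (S ∖ C)  <⟨ +-mono-< (≰⇒> sparseC) (≰⇒> sparseD) ⟩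
      m * size C + m * size (S ∖ C)  ≡⟨ sym (*-distribˡ-+ m (size C) (size (S ∖ C))) ⟩
      m * (size C + size (S ∖ C))    ≡⟨ cong (m *_) (sym size-split) ⟩
      m * size S                     ≤⟨ dense ⟩
      degTotal S                     ≡⟨ degTotal-split ⟩
      degTotal C + degTotal (S ∖ C)  ∎) (<-irrefl refl)
      where open ≤-Reasoning

  record Explored (S : VertexSet K) (c : Fin K) (C : VertexSet K) : Set where
    field
      root∈ : C c ≡ true
      ⊆S    : ∀ {v} → C v ≡ true → S v ≡ true
      reach : ∀ {v} → C v ≡ true → Reachable G c v

  Component : VertexSet K → Fin K → Set
  Component S c = Σ (VertexSet K) λ C → Explored S c C × Closed S C

  Exit : VertexSet K → VertexSet K → Set
  Exit S C = ∃₂ λ v w → C v ≡ true × (S ∖ C) w ≡ true × Adjacent G v w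

  exit? : ∀ S C → Dec (Exit S C)
  exit? S C = any? λ v → any? λ w → (C v ≟ᴮ true) ×-dec ((S ∖ C) w ≟ᴮ true) ×-dec (adj G v w ≟ᴮ true)

  no-exit⇒closed : ∀ S C → ¬ Exit S C → Closed S C
  no-exit⇒closed S C noExit {v} {w} Cv Sw vw with C w in Cw
  ... | true  = refl
  ... | false = contradiction (v , w , Cv , ∈-∖ S C Sw Cw , vw) noExit

  explore-step : ∀ {S c C v w} → Explored S c C → C v ≡ true → (S ∖ C) w ≡ true → Adjacent G v w →
    Explored S c (C ∪ ⁅ w ⁆)
  explore-step {S} {c} {C} {v} {w} explored Cv w∉C vw = record
    { root∈ = cong (_∨ ⁅ w ⁆ c) root∈
    ; ⊆S    = λ u∈ → [ ⊆S , (λ { refl → ∖-⊆ S C w∉C }) ] (∪⁅⁆-cases C u∈)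
    ; reach = λ u∈ → [ reach , (λ { refl → reach Cv ◅◅ (vw ◅ ε) }) ] (∪⁅⁆-cases C u∈)
    }
    where open Explored explored

  explore : ∀ {S c} n C → size (S ∖ C) ≤ n → Explored S c C → Component S c
  explore {S} n C bound explored with exit? S C
  ... | no noExit = C , explored , no-exit⇒closed S C noExit
  explore {S} zero C bound explored | yes (v , w , Cv , w∉C , vw) =
    contradiction bound (<⇒≱ (size-pos (S ∖ C) w∉C))
  explore {S} (suc n) C bound explored | yes (v , w , Cv , w∉C , vw) =
    explore n (C ∪ ⁅ w ⁆) (≤-pred (≤-trans (size-∖-∪⁅⁆ S C w∉C) bound)) (explore-step explored Cv w∉C vw)

  component : ∀ {S c} → S c ≡ true → Component S c
  component {S} {c} Sc = explore (size (S ∖ ⁅ c ⁆)) ⁅ c ⁆ ≤-refl record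
    { root∈ = dec-true (c ≟ c) refl
    ; ⊆S    = λ {v} v∈ → subst (λ u → S u ≡ true) (sym (⁅⁆-eq v∈)) Sc
    ; reach = λ {v} v∈ → subst (Reachable G c) (sym (⁅⁆-eq v∈)) ε
    }

  degreeSum≡degTotal : degreeSum G ≡ degTotal (λ _ → true)
  degreeSum≡degTotal = trans (listSum-tabulate (degree G) id)
    (sum-cong-≗ (λ v → listSum-tabulate (λ u → ⟦ adj G v u ⟧) id))

  all-dense : ∀ {m} → 0 < K → m * K ≤ degreeSum G → Dense m (λ _ → true)
  all-dense {m} 0<K avg-deg =
      subst (0 <_) (sym (∑-one K)) 0<K
    , subst₂ _≤_ (cong (m *_) (sym (∑-one K))) degreeSum≡degTotal avg-deg

  DenseBelow : ℕ → VertexSet K → Set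
  DenseBelow m S = Σ (VertexSet K) λ T → size T < size S × Dense m T

  record Core (m : ℕ) : Set where
    field
      vertices  : VertexSet K
      root      : Fin K
      reachable : ∀ {u} → vertices u ≡ true → Reachable G root u
      min-deg   : ∀ {u} → vertices u ≡ true → m < deg vertices u + deg vertices u
      large     : m < size vertices

  core-or-split : ∀ {m} S → Dense m S → (∀ {u} → S u ≡ true → m < deg S u + deg S u) →
    Core m ⊎ DenseBelow m S
  core-or-split {m} S (nonempty , dense) min-deg
    with c , c∈ ← ∑-pos (λ u → ⟦ S u ⟧) nonempty
    with C , explored , closed ← component {S} (⟦⟧-pos (S c) c∈)
    with any? (λ v → (S ∖ C) v ≟ᴮ true)
  ... | no connected = inj₁ record
    { vertices  = S
    ; root      = c
    ; reachable = reach ∘ S⊆C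
    ; min-deg   = min-deg
    ; large     = dense⇒large S (nonempty , dense)
    }
    where
    open Explored explored
    S⊆C : ∀ {u} → S u ≡ true → C u ≡ true
    S⊆C {u} Su with C u in Cu
    ... | true  = refl
    ... | false = contradiction (u , ∈-∖ S C Su Cu) connected
  ... | yes (v , v∉C) = inj₂ (dense-side (dense-part m dense))
    where
    open Explored explored
    open Split S C ⊆S closed
    C-nonempty : 0 < size C
    C-nonempty = size-pos C root∈
    rest-nonempty : 0 < size (S ∖ C)
    rest-nonempty = size-pos (S ∖ C) v∉C
    dense-side : m * size C ≤ degTotal C ⊎ m * size (S ∖ C) ≤ degTotal (S ∖ C) → DenseBelow m S
    dense-side (inj₁ denseC) =
      C , subst (size C <_) (sym size-split) (m<m+n (size C) rest-nonempty) ,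
      C-nonempty , denseC
    dense-side (inj₂ denseRest) =
      S ∖ C , subst (size (S ∖ C) <_) (sym size-split) (m<n+m (size (S ∖ C)) C-nonempty) ,
      rest-nonempty , denseRest

  core-step : ∀ {m} → 0 < m → ∀ S → Dense m S → Core m ⊎ DenseBelow m S
  core-step {m} m>0 S denseS@(_ , dense)
    with any? (λ w → (S w ≟ᴮ true) ×-dec (deg S w + deg S w ≤? m))
  ... | yes (w , Sw , sparse) =
    inj₂ (S ∖ ⁅ w ⁆ , ≤-reflexive (sym (size-remove S Sw)) , remove-sparse m S m>0 Sw sparse dense)
  ... | no noSparse = core-or-split S denseS min-deg
    where
    min-deg : ∀ {u} → S u ≡ true → m < deg S u + deg S u
    min-deg {u} Su = ≰⇒> (λ sparse → noSparse (u , Su , sparse))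

  core : ∀ {m} → 0 < m → ∀ S → Dense m S → Core m
  core {m} m>0 S = search (size S) S ≤-refl
    where
    search : ∀ n T → size T ≤ n → Dense m T → Core m
    search zero    T bound (nonempty , _) = contradiction bound (<⇒≱ nonempty)
    search (suc n) T bound denseT with core-step m>0 T denseT
    ... | inj₁ found = found
    ... | inj₂ (T′ , smaller , denseT′) = search n T′ (≤-pred (≤-trans smaller bound)) denseT′

  V : List (Edge G) → List (Fin K)
  V = endpoints {G = G}

  adjacent⇒≢ : ∀ {x y} → Adjacent G x y → x ≢ y
  adjacent⇒≢ {x} xy refl = contradiction (trans (sym (irrfl G x)) xy) λ ()

  edge-sum-bound : ∀ (g : Fin K → ℕ) M → All (λ e → g (proj₁ (proj₁ e)) + g (proj₂ (proj₁ e)) ≤ 2) M →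
    listSum (map g (V M)) ≤ length (V M)
  edge-sum-bound g []                  []               = z≤n
  edge-sum-bound g (((a , b) , _) ∷ M) (bound ∷ bounds) =
    ≤-trans (≤-reflexive (sym (+-assoc (g a) (g b) _))) (+-mono-≤ bound (edge-sum-bound g M bounds))

  switch-perm : ∀ M₁ M₂ {a b x y} (ab : Adjacent G a b) (xa : Adjacent G x a) (yb : Adjacent G y b) →
    V (((x , a) , xa) ∷ ((y , b) , yb) ∷ M₁ ++ M₂) ↭ x ∷ y ∷ V (M₁ ++ ((a , b) , ab) ∷ M₂)
  switch-perm M₁ M₂ {a} {b} {x} {y} ab xa yb = begin
    x ∷ a ∷ y ∷ b ∷ V (M₁ ++ M₂)           ≡⟨ cong (λ zs → x ∷ a ∷ y ∷ b ∷ zs) (concatMap-++ _ M₁ M₂) ⟩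
    x ∷ a ∷ y ∷ b ∷ V M₁ ++ V M₂           ↭⟨ ↭-prep x (↭-swap a y ↭-refl) ⟩
    x ∷ y ∷ a ∷ b ∷ V M₁ ++ V M₂           ↭⟨ ↭-prep x (↭-prep y (↭-prep a (↭-sym (shift b (V M₁) (V M₂))))) ⟩
    x ∷ y ∷ a ∷ V M₁ ++ b ∷ V M₂           ↭⟨ ↭-prep x (↭-prep y (↭-sym (shift a (V M₁) (b ∷ V M₂)))) ⟩
    x ∷ y ∷ V M₁ ++ a ∷ b ∷ V M₂           ≡⟨ cong (λ zs → x ∷ y ∷ zs) (sym (concatMap-++ _ M₁ (((a , b) , ab) ∷ M₂))) ⟩
    x ∷ y ∷ V (M₁ ++ ((a , b) , ab) ∷ M₂)  ∎
    where open PermutationReasoning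

  module _ {m : ℕ} (core : Core m) where
    open Core core renaming (vertices to S)
    open SetoidPermutation (setoid (Fin K)) using (Unique-resp-↭)

    record Matching (M : List (Edge G)) : Set where
      field
        unique : Unique (V M)
        inCore : All (λ x → S x ≡ true) (V M)

    Free : List (Fin K) → Fin K → Set
    Free W x = S x ≡ true × x ∉ W

    free? : ∀ W → Decidable (Free W)
    free? W x = (S x ≟ᴮ true) ×-dec ¬? (x ∈? W)

    FreeEdge : List (Fin K) → Set
    FreeEdge W = ∃₂ λ x y → Free W x × Free W y × Adjacent G x y

    free-edge? : ∀ W → Dec (FreeEdge W)
    free-edge? W = any? λ x → any? λ y → free? W x ×-dec free? W y ×-dec (adj G x y ≟ᴮ true)

    Augmenting : List (Fin K) → Edge G → Set
    Augmenting W ((a , b) , _) =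
      ∃₂ λ x y → x ≢ y × Free W x × Free W y × Adjacent G x a × Adjacent G y b

    augmenting? : ∀ W → Decidable (Augmenting W)
    augmenting? W ((a , b) , _) = any? λ x → any? λ y →
      ¬? (x ≟ y) ×-dec free? W x ×-dec free? W y ×-dec (adj G x a ≟ᴮ true) ×-dec (adj G y b ≟ᴮ true)

    Grown : List (Edge G) → Set
    Grown M = Σ (List (Edge G)) λ M′ → Matching M′ × length (V M′) ≡ 2 + length (V M)

    extend : ∀ {M M′ x y} → Matching M → V M′ ↭ x ∷ y ∷ V M → x ≢ y → Free (V M) x → Free (V M) y →
      Matching M′ × length (V M′) ≡ 2 + length (V M)
    extend {M} matching perm x≢y (Sx , x∉) (Sy , y∉) =
      record
        { unique = Unique-resp-↭ (↭⇒↭ₛ (↭-sym perm))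
                     ((x≢y ∷ ¬Any⇒All¬ (V M) x∉) ∷ ¬Any⇒All¬ (V M) y∉ ∷ unique)
        ; inCore = All-resp-↭ (↭-sym perm) (Sx ∷ Sy ∷ inCore)
        }
      , ↭-length perm
      where open Matching matching

    add-free-edge : ∀ {M} → Matching M → FreeEdge (V M) → Grown M
    add-free-edge {M} matching (x , y , free-x , free-y , xy) =
      ((x , y) , xy) ∷ M , extend matching ↭-refl (adjacent⇒≢ xy) free-x free-y

    exchange : ∀ {M} → Matching M → Any (Augmenting (V M)) M → Grown M
    exchange {M} matching augmenting
      with ((a , b) , ab) , e∈M , (x , y , x≢y , free-x , free-y , xa , yb) ← find augmenting
      with M₁ , M₂ , refl ← ∈-∃++ e∈M
      = ((x , a) , xa) ∷ ((y , b) , yb) ∷ M₁ ++ M₂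
      , extend matching (switch-perm M₁ M₂ ab xa yb) x≢y free-x free-y

    free-count : ∀ {M} → Matching M → size S ≤ length (V M) + ∑[ w < K ] ⟦ does (free? (V M) w) ⟧
    free-count {M} matching = begin
      size S                                        ≤⟨ ∑-mono covered-or-free ⟩
      ∑[ w < K ] (⟦ does (w ∈? V M) ⟧ * 1 + ⟦ does (free? (V M) w) ⟧)
                                                    ≡⟨ ∑-distrib-+ {K} _ _ ⟩
      ∑[ w < K ] (⟦ does (w ∈? V M) ⟧ * 1) + #free  ≡⟨ cong (_+ #free) #covered ⟩
      length (V M) + #free                          ∎
      where
      open ≤-Reasoning
      open Matching matching
      #free : ℕ
      #free = ∑[ w < K ] ⟦ does (free? (V M) w) ⟧
      #covered : ∑[ w < K ] (⟦ does (w ∈? V M) ⟧ * 1) ≡ length (V M)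
      #covered = trans (∑-members (V M) unique (λ _ → 1)) (listSum-ones (V M))
      covered-or-free : ∀ w → ⟦ S w ⟧ ≤ ⟦ does (w ∈? V M) ⟧ * 1 + ⟦ does (free? (V M) w) ⟧
      covered-or-free w with w ∈? V M | S w
      ... | yes _ | s     = ≤-trans (⟦⟧≤1 s) (m≤m+n 1 _)
      ... | no _  | true  = ≤-refl
      ... | no _  | false = z≤n

    -- A matching covering fewer than m vertices leaves two free vertices, since the core
    -- has more than m vertices.
    two-free : ∀ {M} → Matching M → length (V M) < m → ∃₂ λ u v → u ≢ v × Free (V M) u × Free (V M) v
    two-free {M} matching short = two-witnesses (free? (V M)) (+-cancelˡ-≤ (length (V M)) 2 _ (begin
      length (V M) + 2                                    ≡⟨ +-comm (length (V M)) 2 ⟩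
      2 + length (V M)                                    ≤⟨ s≤s short ⟩
      suc m                                               ≤⟨ large ⟩
      size S                                              ≤⟨ free-count matching ⟩
      length (V M) + ∑[ w < K ] ⟦ does (free? (V M) w) ⟧  ∎))
      where open ≤-Reasoning

    -- Without free and augmenting edges, all neighbours of free vertices u ≠ v are covered,
    -- and each matching edge meets at most two of their edges: deg u + deg v ≤ |V M|.
    deg-pair-bound : ∀ {M u v} → Matching M → ¬ FreeEdge (V M) → All (¬_ ∘ Augmenting (V M)) M →
      u ≢ v → Free (V M) u → Free (V M) v → deg S u + deg S v ≤ length (V M)
    deg-pair-bound {M} {u} {v} matching noFree noAugmenting u≢v free-u free-v = begin
      deg S u + deg S v                                       ≡⟨ sym (∑-distrib-+ {K} _ _) ⟩
      ∑[ w < K ] (⟦ S w ∧ adj G u w ⟧ + ⟦ S w ∧ adj G v w ⟧)  ≤⟨ ∑-mono nbrs-covered ⟩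
      ∑[ w < K ] (⟦ does (w ∈? V M) ⟧ * g w)                  ≡⟨ ∑-members (V M) unique g ⟩
      listSum (map g (V M))                                   ≤⟨ edge-sum-bound g M (All.map (λ {e} → per-edge e) noAugmenting) ⟩
      length (V M)                                            ∎
      where
      open ≤-Reasoning
      open Matching matching
      g : Fin K → ℕ
      g w = ⟦ adj G u w ⟧ + ⟦ adj G v w ⟧
      nbrs-covered : ∀ w → ⟦ S w ∧ adj G u w ⟧ + ⟦ S w ∧ adj G v w ⟧ ≤ ⟦ does (w ∈? V M) ⟧ * g w
      nbrs-covered w with w ∈? V M | S w in Sw
      ... | yes _ | s     = ≤-trans (+-mono-≤ (⟦∧⟧≤ s (adj G u w)) (⟦∧⟧≤ s (adj G v w))) (m≤m+n _ 0)
      ... | no _  | false = z≤n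
      ... | no w∉ | true with adj G u w in uw | adj G v w in vw
      ...   | true  | _     = contradiction (u , w , free-u , (Sw , w∉) , uw) noFree
      ...   | false | true  = contradiction (v , w , free-v , (Sw , w∉) , vw) noFree
      ...   | false | false = z≤n
      per-edge : ∀ e → ¬ Augmenting (V M) e → g (proj₁ (proj₁ e)) + g (proj₂ (proj₁ e)) ≤ 2
      per-edge ((a , b) , _) notAugmenting = at-most-two (adj G u a) (adj G v a) (adj G u b) (adj G v b)
        (λ ua vb → notAugmenting (u , v , u≢v , free-u , free-v , ua , vb))
        (λ va ub → notAugmenting (v , u , u≢v ∘ sym , free-v , free-u , va , ub))

    saturated : ∀ {M} → Matching M → ¬ FreeEdge (V M) → All (¬_ ∘ Augmenting (V M)) M → m ≤ length (V M)
    saturated {M} matching noFree noAugmenting = ≮⇒≥ λ short → <-asym short (covers-more short)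
      where
      -- two free vertices have more than m neighbours in total, all of them covered
      covers-more : length (V M) < m → m < length (V M)
      covers-more short =
        let u , v , u≢v , free-u , free-v = two-free matching short
        in <-≤-trans (mean-bound {m} {deg S u} {deg S v} (min-deg (proj₁ free-u)) (min-deg (proj₁ free-v)))
                     (deg-pair-bound matching noFree noAugmenting u≢v free-u free-v)

    grow-step : ∀ {M} → Matching M → Grown M ⊎ m ≤ length (V M)
    grow-step {M} matching with free-edge? (V M) | Any.any? (augmenting? (V M)) M
    ... | yes freeEdge | _              = inj₁ (add-free-edge matching freeEdge)
    ... | no _         | yes augmenting = inj₁ (exchange matching augmenting)
    ... | no noFree    | no noAugmenting =
      inj₂ (saturated matching noFree (¬Any⇒All¬ M noAugmenting))

    grow : ∀ n {M} → Matching M → m ≤ length (V M) + n →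
      Σ (List (Edge G)) λ M′ → Matching M′ × m ≤ length (V M′)
    grow zero    {M} matching enough = M , matching , subst (m ≤_) (+-identityʳ _) enough
    grow (suc n) {M} matching enough with grow-step matching
    ... | inj₂ done                  = M , matching , done
    ... | inj₁ (M′ , matching′ , grew) = grow n matching′ (begin
      m                       ≤⟨ enough ⟩
      length (V M) + suc n    ≡⟨ +-suc (length (V M)) n ⟩
      suc (length (V M) + n)  ≤⟨ n≤1+n _ ⟩
      2 + length (V M) + n    ≡⟨ cong (_+ n) (sym grew) ⟩
      length (V M′) + n       ∎)
      where open ≤-Reasoning

    connected-matching : Σ (List (Edge G)) λ M → IsConnectedMatching G M × m ≤ covered {G = G} M
    connected-matching
      with M , matching , enough ← grow m {[]} (record { unique = [] ; inCore = [] }) ≤-refl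
      = M , (Matching.unique matching , root , All.map reachable (Matching.inCore matching)) , enough

corollary6p9 : (K : ℕ) (G : Graph K) (m : ℕ) → 3 ≤ m → m ≤ K →
    m * K ≤ degreeSum G →
    Σ (List (Edge G)) λ M → IsConnectedMatching G M × m ≤ covered {G = G} M
corollary6p9 K G m 3≤m m≤K avg-deg =
  connected-matching G (core G 0<m (λ _ → true) (all-dense G {m} (≤-trans 0<m m≤K) avg-deg))
  where
  0<m : 0 < m
  0<m = ≤-trans (s≤s z≤n) 3≤m
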